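{- Let $\Phi$, $G$ and $k$ be as described in the context. If $\Phi$ is satisfiable, then there exists a clique cover of $G$ of size $k$, i.e., a family of $k$ vertex sets, each inducing a complete subgraph of $G$, such that every edge of $G$ has both endpoints in some member of the family.
   Context: Let $n = 2^\ell$ with $\ell \geq 1$ and let $\Phi = \Psi_0 \wedge \dots \wedge \Psi_{m-1}$ ($m\ge1$) be a 3-CNF formula over variables $x_0,\dots,x_{n-1}$ in which every clause consists of exactly three literals on pairwise distinct variables, the variable $x_0$ occurs in no clause, and which has the property that if $\Phi$ is satisfiable then it has a satisfying assignment that sets exactly $n/2$ variables to true and sets $x_0$ to false. For $0 \le j < m$ and $\alpha \in \{1,2,3\}$, let $i(j,\alpha)$ be the index of the variable of the $\alpha$-th literal of $\Psi_j$, and $c(j,\alpha) = 1$ if this literal is positive, $c(j,\alpha)=0$ if negative. The graph $G_0$ has vertices $w^\eta_{i,c}$ ($\eta\in\{1,2\}$, $0\le i<n$, $c\in\{0,1\}$), $u^\eta_\gamma$ ($\eta\in\{1,2\}$, $1\le\gamma\le \ell-1$), $p_{j,\alpha,\beta}$ ($0\le j<m$, $\alpha\in\{1,2,3\}$, $\beta\in\{1,2\}$), $q_{a,b}$ ($a,b\in\{1,2\}$), and edge set $E^{\mathrm{imp}} \cup E^{\mathrm{free}}$ where $E^{\mathrm{imp}}$ consists of: $w^\eta_{i,0}w^\eta_{i',1}$ for all $\eta$ and $i\ne i'$; $u^\eta_\gamma w^\eta_{i,c}$ for all $\eta,\gamma,i,c$; $p_{j,\alpha,1}p_{j,\alpha,2}$;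 $q_{a,1}q_{a,2}$; and $E^{\mathrm{free}}$ consists of: $w^\eta_{i,c}w^\eta_{i',c}$ for $i\ne i'$; $w^1_{i,c}w^2_{i',c'}$ for all $i,c,i',c'$; $q_{a,b}p_{j,\alpha,\beta}$ for all indices; $p_{j,\alpha,\beta}p_{j',\alpha',\beta'}$ for $j\ne j'$; $p_{j,\alpha,\beta}w^\eta_{i,c}$ for all $j,\alpha,\beta,\eta$ and $(i,c) \notin \{(0,1),(i(j,\alpha),1-c(j,\alpha))\}$; no other edges. For a nonnegative integer $t$, "the $\gamma$-th bit of $t$" means the $\gamma$-th least significant bit of its binary representation. Let $\mathcal{D}$ be the following indexed family of vertex sets (cliques of $(V(G_0),E^{\mathrm{free}})$), of total size $N = 46 + 36\lceil\log_2 m\rceil + 24\ell$: (1) for $(c,c')\in\{0,1\}^2$: $\{w^1_{i,c}: 0\le i<n\}\cup\{w^2_{i,c'}:0\le i<n\}$; (2) for $(a,b,\alpha',\beta')\in\{1,2\}^2\times\{1,2,3\}\times\{1,2\}$: $\{q_{a,b}\}\cup\{p_{j,\alpha',\beta'}:0\le j<m\}$; (3) for $1\le\gamma\le\lceil\log_2 m\rceil$ and $(\alpha,\beta,\alpha',\beta')\in(\{1,2,3\}\times\{1,2\})^2$: $\{p_{j,\alpha,\beta}: \text{the }\gamma\text{ -th bit of } j \text{ is } 0\}\cup\{p_{j,\alpha',\beta'}: \text{the }\gamma\text{ -th bit of } j\text{ is }1\}$; (4) for $(\alpha,\beta)\in\{1,2,3\}\times\{1,2\}$: $\{w^1_{0,0},w^2_{0,0}\}\cup\{p_{j,\alpha,\beta}:0\le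 j<m\}$; (5) for $(\alpha,\beta,c)\in\{1,2,3\}\times\{1,2\}\times\{0,1\}$: $\{w^\eta_{i,c}:1\le i<n,\eta\in\{1,2\}\}\cup\{p_{j,\alpha,\beta}: c(j,\alpha)=c\}$; (6) for $1\le\gamma\le\ell$ and $(\alpha,\beta,c,c')\in\{1,2,3\}\times\{1,2\}\times\{0,1\}^2$: $\{w^\eta_{i,c}:\eta\in\{1,2\},1\le i<n,\text{ the }\gamma\text{ -th bit of } i\text{ is } c'\}\cup\{p_{j,\alpha,\beta}: \text{the }\gamma\text{ -th bit of } i(j,\alpha)\text{ is } 1-c'\}$. The graph $G$ is obtained from $G_0$ by adding, for each of the $N$ members $D$ of $\mathcal{D}$, a new vertex $s_D$ adjacent exactly to the vertices of $D$ (the new vertices are pairwise non-adjacent). Set $k = 4\ell + 46 + 36\lceil\log_2 m\rceil + 24\ell$. -}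

module Defs where

open import Data.Nat using (ℕ; zero; suc; _+_; _*_; _∸_; _^_; _≤_; _≡ᵇ_)
open import Data.Nat.DivMod using (_/_; _%_)
open import Data.Nat.Logarithm using (⌈log₂_⌉)
open import Data.Fin using (Fin; toℕ) renaming (zero to 0F)
open import Data.Bool using (Bool; true; false; not; if_then_else_)
open import Data.Product using (Σ; ∃; _×_; _,_)
open import Data.Sum using (_⊎_)
open import Data.Empty using (⊥)
open import Data.List using (List; map; allFin)
open import Data.Nat.ListAction using (sum)
open import Relation.Nullary using (¬_)
open import Relation.Binary.PropositionalEquality using (_≡_; _≢_)

pattern 1F = Fin.suc 0F

-- testBit r t : the r-th least significant bit of t, counting from r = 0.
-- Hence "the γ-th bit of t" (γ ≥ 1) of the paper is testBit (γ ∸ 1) t.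
testBit : ℕ → ℕ → Bool
testBit zero    t = (t % 2) ≡ᵇ 1
testBit (suc r) t = testBit r (t / 2)

-- A 3-CNF formula with m clauses over variables x_0..x_{n-1}:
-- lit j α = (i(j,α) , c(j,α)), c = true means positive literal.
-- α ∈ Fin 3 stands for α ∈ {1,2,3} (0F ↦ 1, etc.).
Formula : ℕ → ℕ → Set
Formula n m = Fin m → Fin 3 → Fin n × Bool

module _ {n m : ℕ} (Φ : Formula n m) where

  var : Fin m → Fin 3 → Fin n
  var j α = Data.Product.proj₁ (Φ j α)

  sign : Fin m → Fin 3 → Bool
  sign j α = Data.Product.proj₂ (Φ j α)

  DistinctVars : Set
  DistinctVars = ∀ j α α' → α ≢ α' → var j α ≢ var j α'

  X0Unused : Set
  X0Unused = ∀ j α → toℕ (var j α) ≢ 0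

  Satisfies : (Fin n → Bool) → Set
  Satisfies a = ∀ j → ∃ λ α → a (var j α) ≡ sign j α

  Satisfiable : Set
  Satisfiable = ∃ λ a → Satisfies a

  countTrue : (Fin n → Bool) → ℕ
  countTrue a = sum (map (λ i → if a i then 1 else 0) (allFin n))

  BalancedProperty : Set
  BalancedProperty = Satisfiable → ∃ λ a → Satisfies a × countTrue a ≡ n / 2
                                           × (∀ i → toℕ i ≡ 0 → a i ≡ false)

-- The graph G.  Indices η, β, a, b ∈ {1,2} are encoded as Fin 2
-- (0F ↦ 1, 1F ↦ 2); c ∈ {0,1} as Bool (false ↦ 0, true ↦ 1).

module Construction (ℓ m : ℕ) (Φ : Formula (2 ^ ℓ) m) where

  n : ℕ
  n = 2 ^ ℓ

  -- index set of the family 𝒟 (items (1)–(6)); γ : Fin L stands for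
  -- γ = toℕ γ + 1 ∈ {1..L}, so its zero-based bit index is toℕ γ.
  data DIdx : Set where
    d1 : (c c' : Bool) → DIdx
    d2 : (a b : Fin 2) (α' : Fin 3) (β' : Fin 2) → DIdx
    d3 : (γ : Fin ⌈log₂ m ⌉) (α : Fin 3) (β : Fin 2) (α' : Fin 3) (β' : Fin 2) → DIdx
    d4 : (α : Fin 3) (β : Fin 2) → DIdx
    d5 : (α : Fin 3) (β : Fin 2) (c : Bool) → DIdx
    d6 : (γ : Fin ℓ) (α : Fin 3) (β : Fin 2) (c c' : Bool) → DIdx

  -- vertices of G; u η γ with γ : Fin (ℓ ∸ 1) stands for u^η_{toℕ γ + 1}
  data V : Set where
    w : (η : Fin 2) (i : Fin n) (c : Bool) → V
    u : (η : Fin 2) (γ : Fin (ℓ ∸ 1)) → V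
    p : (j : Fin m) (α : Fin 3) (β : Fin 2) → V
    q : (a b : Fin 2) → V
    s : DIdx → V

  InD : DIdx → V → Set
  InD (d1 c c') (w η i c'') = (η ≡ 0F × c'' ≡ c) ⊎ (η ≡ 1F × c'' ≡ c')
  InD (d1 c c') _ = ⊥
  InD (d2 a b α' β') (q a' b') = a' ≡ a × b' ≡ b
  InD (d2 a b α' β') (p j α β) = α ≡ α' × β ≡ β'
  InD (d2 a b α' β') _ = ⊥
  InD (d3 γ α β α' β') (p j a b) =
      (testBit (toℕ γ) (toℕ j) ≡ false × a ≡ α × b ≡ β)
    ⊎ (testBit (toℕ γ) (toℕ j) ≡ true × a ≡ α' × b ≡ β')
  InD (d3 γ α β α' β') _ = ⊥
  InD (d4 α β) (w η i c) = toℕ i ≡ 0 × c ≡ false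
  InD (d4 α β) (p j a b) = a ≡ α × b ≡ β
  InD (d4 α β) _ = ⊥
  InD (d5 α β c) (w η i c') = 1 ≤ toℕ i × c' ≡ c
  InD (d5 α β c) (p j a b) = a ≡ α × b ≡ β × sign Φ j α ≡ c
  InD (d5 α β c) _ = ⊥
  InD (d6 γ α β c c') (w η i c'') =
    c'' ≡ c × 1 ≤ toℕ i × testBit (toℕ γ) (toℕ i) ≡ c'
  InD (d6 γ α β c c') (p j a b) =
    a ≡ α × b ≡ β × testBit (toℕ γ) (toℕ (var Φ j α)) ≡ not c'
  InD (d6 γ α β c c') _ = ⊥

  data Edge : V → V → Set where
    imp-ww : ∀ {η i i'} → i ≢ i' → Edge (w η i false) (w η i' true)
    imp-uw : ∀ {η γ i c} → Edge (u η γ) (w η i c)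
    imp-pp : ∀ {j α} → Edge (p j α 0F) (p j α 1F)
    imp-qq : ∀ {a} → Edge (q a 0F) (q a 1F)
    free-ww : ∀ {η i i' c} → i ≢ i' → Edge (w η i c) (w η i' c)
    free-w12 : ∀ {i c i' c'} → Edge (w 0F i c) (w 1F i' c')
    free-qp : ∀ {a b j α β} → Edge (q a b) (p j α β)
    free-pp : ∀ {j α β j' α' β'} → j ≢ j' → Edge (p j α β) (p j' α' β')
    free-pw : ∀ {j α β η i c} →
              ¬ (toℕ i ≡ 0 × c ≡ true) →
              ¬ (i ≡ var Φ j α × c ≡ not (sign Φ j α)) →
              Edge (p j α β) (w η i c)
    sD : ∀ {D x} → InD D x → Edge (s D) x

  Adj : V → V → Set
  Adj x y = Edge x y ⊎ Edge y x

  IsClique : (V → Set) → Set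
  IsClique C = ∀ x y → C x → C y → x ≢ y → Adj x y

  CliqueCover : ℕ → Set₁
  CliqueCover k = Σ (Fin k → V → Set) λ C →
                    (∀ t → IsClique (C t))
                  × (∀ x y → Adj x y → ∃ λ t → C t x × C t y)

kParam : ℕ → ℕ → ℕ
kParam ℓ m = 4 * ℓ + 46 + 36 * ⌈log₂ m ⌉ + 24 * ℓ

module Submission where

-- Fix a satisfying assignment σ with n/2 true variables and σ(x₀) = false.  The closed
-- neighbourhoods N[s_D] = {s_D} ∪ D cover E^free and the edges at the s_D.  The remaining 4ℓ
-- cliques cover E^imp: the vertices w_{i,σ(i)} together with p_{j,α,β} for one literal α of Ψ_j
-- satisfied by σ; the vertices w_{i,¬σ(i)}; for each a the vertices q_{a,b} together with the
-- p_{j,α,β} at the a-th remaining position α of Ψ_j; and for each η, each γ < ℓ − 1 and each bit b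
-- the vertex u^η_γ with the w^η_{i,c} such that c = b xor (bit γ of the label of i).  The label of
-- i is its rank among the variables sharing its σ-value.  Both σ-classes have n/2 = 2^(ℓ−1)
-- elements, so labels have ℓ − 1 bits, and for i ≠ i' either σ(i) ≠ σ(i') or some label bit
-- differs; in both cases some clique above contains w^η_{i,0} and w^η_{i',1}.

open import Defs
open import Data.Nat using (ℕ; zero; suc; _+_; _*_; _^_; _≤_; _<_; _<ᵇ_; _≡ᵇ_; z≤n; s≤s; ⌈_/2⌉)
open import Data.Nat.Properties
open import Data.Nat.DivMod using (_/_; _%_; m≡m%n+[m/n]*n; m%n<n; m<n*o⇒m/o<n; m*n/n≡m)
open import Data.Nat.Induction using (<-wellFounded)
open import Data.Nat.Logarithm using (⌈log₂_⌉)
open import Data.Nat.Logarithm.Core using (⌈log2⌉)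
open import Data.Nat.ListAction using (sum)
open import Data.Nat.Tactic.RingSolver using (solve-∀)
open import Data.Fin using (Fin; toℕ; punchIn; punchOut) renaming (zero to 0F; suc to 1+_)
open import Data.Fin.Properties using (toℕ-injective; toℕ<n; punchIn-punchOut; +↔⊎; *↔×; 2↔Bool)
open import Data.Bool using (Bool; true; false; not; _∧_; _xor_; if_then_else_; T)
open import Data.Bool.Properties using (T-∧; not-¬; ¬-not; not-involutive; xor-assoc; xor-same)
open import Data.List using (tabulate)
open import Data.List.Properties using (map-tabulate)
open import Data.Product using (∃; _×_; _,_; proj₁; proj₂)
import Data.Product as Product
open import Data.Product.Function.NonDependent.Propositional using (_×-↠_)
open import Data.Sum using (_⊎_; inj₁; inj₂; [_,_])
open import Data.Sum.Function.Propositional using (_⊎-↠_)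
open import Data.Empty using (⊥-elim)
open import Function using (_∘_; id; Equivalence)
open import Function.Bundles using (_↠_; mk↠ₛ; Surjection)
open import Function.Construct.Composition using (_↠-∘_)
open import Function.Construct.Identity using (↠-id)
open import Function.Properties.Inverse using (↔⇒↠)
open import Induction.WellFounded using (Acc; acc)
open import Relation.Nullary using (¬_; yes; no)
open import Relation.Binary.Definitions using (tri<; tri≈; tri>)
open import Relation.Binary.PropositionalEquality hiding ([_])

private
  testBit-0-cong : ∀ a b → testBit 0 a ≡ testBit 0 b → a % 2 ≡ b % 2
  testBit-0-cong a b = bits (m%n<n a 2) (m%n<n b 2)
    where
    bits : ∀ {x y} → x < 2 → y < 2 → (x ≡ᵇ 1) ≡ (y ≡ᵇ 1) → x ≡ y
    bits {0} {0} _ _ _ = refl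
    bits {1} {1} _ _ _ = refl
    bits {0} {1} _ _ ()
    bits {1} {0} _ _ ()
    bits {suc (suc _)} (s≤s (s≤s ())) _ _
    bits {_} {suc (suc _)} _ (s≤s (s≤s ())) _

differingBit : ∀ k {a b} → a < 2 ^ k → b < 2 ^ k → a ≢ b →
               ∃ λ (r : Fin k) → testBit (toℕ r) a ≢ testBit (toℕ r) b
differingBit zero {0} {0} _ _ a≢b = ⊥-elim (a≢b refl)
differingBit zero {suc _} (s≤s ()) _ _
differingBit zero {0} {suc _} _ (s≤s ()) _
differingBit (suc k) {a} {b} a< b< a≢b with testBit 0 a Data.Bool.≟ testBit 0 b
... | no last≢ = 0F , last≢
... | yes last≡ = Product.map 1+_ id (differingBit k (half< a<) (half< b<) halves≢)
  where
  half< : ∀ {x} → x < 2 ^ suc k → x / 2 < 2 ^ k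
  half< {x} x< = m<n*o⇒m/o<n (subst (x <_) (*-comm 2 (2 ^ k)) x<)

  halves≢ : a / 2 ≢ b / 2
  halves≢ halves≡ = a≢b (begin
    a                  ≡⟨ m≡m%n+[m/n]*n a 2 ⟩
    a % 2 + a / 2 * 2  ≡⟨ cong₂ (λ r h → r + h * 2) (testBit-0-cong a b last≡) halves≡ ⟩
    b % 2 + b / 2 * 2  ≡⟨ m≡m%n+[m/n]*n b 2 ⟨
    b                  ∎)
    where open ≡-Reasoning

n≤2^⌈log2⌉n : ∀ n (rec : Acc _<_ n) → n ≤ 2 ^ ⌈log2⌉ n rec
n≤2^⌈log2⌉n 0 _ = z≤n
n≤2^⌈log2⌉n 1 _ = ≤-refl
n≤2^⌈log2⌉n (suc (suc n)) (acc rs) = begin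
  2 + n                           ≤⟨ +-monoʳ-≤ 2 n≤h+h ⟩
  2 + (h + h)                     ≡⟨ double-suc h ⟩
  2 * suc h                       ≤⟨ *-monoʳ-≤ 2 (n≤2^⌈log2⌉n (suc h) (rs (⌈n/2⌉<n n))) ⟩
  2 * 2 ^ ⌈log2⌉ (suc h) (rs (⌈n/2⌉<n n)) ∎
  where
  open ≤-Reasoning
  h : ℕ
  h = ⌈ n /2⌉
  n≤h+h : n ≤ h + h
  n≤h+h = subst (_≤ h + h) (⌊n/2⌋+⌈n/2⌉≡n n) (+-monoˡ-≤ h (⌊n/2⌋≤⌈n/2⌉ n))
  double-suc : ∀ x → 2 + (x + x) ≡ 2 * suc x
  double-suc = solve-∀

n≤2^⌈log₂n⌉ : ∀ n → n ≤ 2 ^ ⌈log₂ n ⌉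
n≤2^⌈log₂n⌉ n = n≤2^⌈log2⌉n n (<-wellFounded n)

toℕ<2^⌈log₂n⌉ : ∀ {n} (j : Fin n) → toℕ j < 2 ^ ⌈log₂ n ⌉
toℕ<2^⌈log₂n⌉ {n} j = <-≤-trans (toℕ<n j) (n≤2^⌈log₂n⌉ n)

count : ∀ {n} → (Fin n → Bool) → ℕ
count P = sum (tabulate (λ i → if P i then 1 else 0))

countTrue≡count : ∀ {n m} (Φ : Formula n m) (a : Fin n → Bool) → countTrue Φ a ≡ count a
countTrue≡count Φ a = cong sum (map-tabulate id (λ i → if a i then 1 else 0))

count-complement : ∀ {n} (P : Fin n → Bool) → count P + count (not ∘ P) ≡ n
count-complement {zero} P = refl
count-complement {suc n} P with P 0F
... | true  = cong suc (count-complement (P ∘ 1+_))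
... | false = trans (+-suc _ _) (cong suc (count-complement (P ∘ 1+_)))

_⊆ᵇ_ : ∀ {n} → (Fin n → Bool) → (Fin n → Bool) → Set
P ⊆ᵇ Q = ∀ {j} → T (P j) → T (Q j)

count-mono : ∀ {n} {P Q : Fin n → Bool} → P ⊆ᵇ Q → count P ≤ count Q
count-mono {zero} _ = z≤n
count-mono {suc n} {P} {Q} P⊆Q with P 0F | Q 0F | P⊆Q {0F}
... | true  | true  | _    = s≤s (count-mono {P = P ∘ 1+_} {Q ∘ 1+_} P⊆Q)
... | true  | false | 0∈Q  = ⊥-elim (0∈Q _)
... | false | true  | _    = m≤n⇒m≤1+n (count-mono {P = P ∘ 1+_} {Q ∘ 1+_} P⊆Q)
... | false | false | _    = count-mono {P = P ∘ 1+_} {Q ∘ 1+_} P⊆Q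

count-< : ∀ {n} {P Q : Fin n → Bool} → P ⊆ᵇ Q →
          ∀ i → T (Q i) → ¬ T (P i) → count P < count Q
count-< {suc n} {P} {Q} P⊆Q 0F with P 0F | Q 0F
... | false | true  = λ _ _ → s≤s (count-mono {P = P ∘ 1+_} {Q ∘ 1+_} P⊆Q)
... | true  | _     = λ _ i∉P → ⊥-elim (i∉P _)
... | false | false = λ ()
count-< {suc n} {P} {Q} P⊆Q (1+ i) i∈Q i∉P with P 0F | Q 0F | P⊆Q {0F}
... | true  | true  | _   = s≤s (count-< {P = P ∘ 1+_} {Q ∘ 1+_} P⊆Q i i∈Q i∉P)
... | true  | false | 0∈Q = ⊥-elim (0∈Q _)
... | false | true  | _   = m<n⇒m<1+n (count-< {P = P ∘ 1+_} {Q ∘ 1+_} P⊆Q i i∈Q i∉P)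
... | false | false | _   = count-< {P = P ∘ 1+_} {Q ∘ 1+_} P⊆Q i i∈Q i∉P

rank : ∀ {n} → (Fin n → Bool) → Fin n → ℕ
rank P i = count (λ j → (toℕ j <ᵇ toℕ i) ∧ P j)

module _ {n : ℕ} {P : Fin n → Bool} where

  private
    <ᵇ-irrefl : ∀ a → ¬ T (a <ᵇ a)
    <ᵇ-irrefl a a<a = <-irrefl refl (<ᵇ⇒< a a a<a)

    split : ∀ {a b} → T (a ∧ b) → T a × T b
    split = Equivalence.to T-∧

  rank<count : ∀ {i} → T (P i) → rank P i < count P
  rank<count {i} i∈P =
    count-< (proj₂ ∘ split) i i∈P (<ᵇ-irrefl (toℕ i) ∘ proj₁ ∘ split)

  rank-< : ∀ {i i'} → T (P i) → toℕ i < toℕ i' → rank P i < rank P i'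
  rank-< {i} {i'} i∈P i<i' =
    count-< below-i⊆below-i' i (Equivalence.from T-∧ (<⇒<ᵇ i<i' , i∈P))
            (<ᵇ-irrefl (toℕ i) ∘ proj₁ ∘ split)
    where
    below-i⊆below-i' : (λ j → (toℕ j <ᵇ toℕ i) ∧ P j) ⊆ᵇ (λ j → (toℕ j <ᵇ toℕ i') ∧ P j)
    below-i⊆below-i' {j} j∈ with split j∈
    ... | j<i , j∈P = Equivalence.from T-∧ (<⇒<ᵇ (<-trans (<ᵇ⇒< _ _ j<i) i<i') , j∈P)

  rank-injective : ∀ {i i'} → T (P i) → T (P i') → rank P i ≡ rank P i' → i ≡ i'
  rank-injective {i} {i'} i∈P i'∈P same with <-cmp (toℕ i) (toℕ i')
  ... | tri< i<i' _ _ = ⊥-elim (<-irrefl same (rank-< i∈P i<i'))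
  ... | tri≈ _ i≡i' _ = toℕ-injective i≡i'
  ... | tri> _ _ i'<i = ⊥-elim (<-irrefl (sym same) (rank-< i'∈P i'<i))

enum-Fin : ∀ {k} → Fin k ↠ Fin k
enum-Fin = ↠-id _

enum-Bool : Fin 2 ↠ Bool
enum-Bool = ↔⇒↠ 2↔Bool

enum-⊎ : ∀ {a b} {A B : Set} → Fin a ↠ A → Fin b ↠ B → Fin (a + b) ↠ (A ⊎ B)
enum-⊎ f g = (f ⊎-↠ g) ↠-∘ ↔⇒↠ +↔⊎

enum-× : ∀ {a b} {A B : Set} → Fin a ↠ A → Fin b ↠ B → Fin (a * b) ↠ (A × B)
enum-× f g = (f ×-↠ g) ↠-∘ ↔⇒↠ *↔×

enum-image : ∀ {k} {A B : Set} → Fin k ↠ A → (f : A → B) → (∀ y → ∃ λ x → f x ≡ y) → Fin k ↠ B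
enum-image e f f-onto = mk↠ₛ {to = f} f-onto ↠-∘ e

module BalancedLabels {ℓ' : ℕ} (σ : Fin (2 ^ suc ℓ') → Bool) (balanced : count σ ≡ 2 ^ ℓ') where

  -- class true reduces to σ and class false to not ∘ σ.
  class : Bool → Fin (2 ^ suc ℓ') → Bool
  class b j = not b xor σ j

  ∈class : ∀ {b j} → σ j ≡ b → T (class b j)
  ∈class {j = j} refl with σ j
  ... | true  = _
  ... | false = _

  class-count : ∀ b → count (class b) ≡ 2 ^ ℓ'
  class-count true  = balanced
  class-count false = trans (+-cancelˡ-≡ (2 ^ ℓ') _ _ (begin
    2 ^ ℓ' + count (not ∘ σ)   ≡⟨ cong (_+ count (not ∘ σ)) balanced ⟨
    count σ + count (not ∘ σ)  ≡⟨ count-complement σ ⟩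
    2 ^ ℓ' + (2 ^ ℓ' + 0)      ∎)) (+-identityʳ (2 ^ ℓ'))
    where open ≡-Reasoning

  label : Fin (2 ^ suc ℓ') → ℕ
  label i = rank (class (σ i)) i

  label< : ∀ i → label i < 2 ^ ℓ'
  label< i = subst (label i <_) (class-count (σ i)) (rank<count {P = class (σ i)} (∈class refl))

  label-injective : ∀ {i i'} → σ i ≡ σ i' → label i ≡ label i' → i ≡ i'
  label-injective {i} {i'} σi≡σi' same =
    rank-injective {P = class (σ i)} (∈class refl) (∈class (sym σi≡σi'))
                   (trans same (cong (λ b → rank (class b) i') (sym σi≡σi')))

  labelBit : Fin ℓ' → Fin (2 ^ suc ℓ') → Bool
  labelBit γ i = testBit (toℕ γ) (label i)

  distinguish : ∀ {i i'} → i ≢ i' → σ i ≢ σ i' ⊎ ∃ λ γ → labelBit γ i ≢ labelBit γ i'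
  distinguish {i} {i'} i≢i' with σ i Data.Bool.≟ σ i'
  ... | no σi≢σi' = inj₁ σi≢σi'
  ... | yes σi≡σi' =
    inj₂ (differingBit ℓ' (label< i) (label< i') (i≢i' ∘ label-injective σi≡σi'))

module Graph (ℓ m : ℕ) (Φ : Formula (2 ^ ℓ) m) where

  open Construction ℓ m Φ

  w-adjacent-same-η : ∀ {η i i' c c'} → (i ≡ i' → c ≡ c') →
                      w η i c ≢ w η i' c' → Adj (w η i c) (w η i' c')
  w-adjacent-same-η {η} {i} {i'} {c} {c'} same-c x≢y with i Data.Fin.≟ i'
  ... | yes refl = ⊥-elim (x≢y (cong (w η i) (same-c refl)))
  ... | no i≢i' with c | c'
  ...   | false | false = inj₁ (free-ww i≢i')
  ...   | true  | true  = inj₁ (free-ww i≢i')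
  ...   | false | true  = inj₁ (imp-ww i≢i')
  ...   | true  | false = inj₂ (imp-ww (≢-sym i≢i'))

  w-adjacent : ∀ {η η' i i' c c'} → (η ≡ η' → i ≡ i' → c ≡ c') →
               w η i c ≢ w η' i' c' → Adj (w η i c) (w η' i' c')
  w-adjacent {0F}    {0F}    same-c = w-adjacent-same-η (same-c refl)
  w-adjacent {1+ 0F} {1+ 0F} same-c = w-adjacent-same-η (same-c refl)
  w-adjacent {0F}    {1+ 0F} _ _    = inj₁ free-w12
  w-adjacent {1+ 0F} {0F}    _ _    = inj₂ free-w12

  p-adjacent-same-literal : ∀ {j α β β'} → p j α β ≢ p j α β' → Adj (p j α β) (p j α β')
  p-adjacent-same-literal {β = 0F}    {0F}    x≢y = ⊥-elim (x≢y refl)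
  p-adjacent-same-literal {β = 1+ 0F} {1+ 0F} x≢y = ⊥-elim (x≢y refl)
  p-adjacent-same-literal {β = 0F}    {1+ 0F} _   = inj₁ imp-pp
  p-adjacent-same-literal {β = 1+ 0F} {0F}    _   = inj₂ imp-pp

  p-adjacent : ∀ {j α β j' α' β'} → (j ≡ j' → α ≡ α') →
               p j α β ≢ p j' α' β' → Adj (p j α β) (p j' α' β')
  p-adjacent {j} {j' = j'} same-α x≢y with j Data.Fin.≟ j'
  ... | no j≢j' = inj₁ (free-pp j≢j')
  ... | yes refl with same-α refl
  ...   | refl = p-adjacent-same-literal x≢y

  q-adjacent : ∀ {a b b'} → q a b ≢ q a b' → Adj (q a b) (q a b')
  q-adjacent {b = 0F}    {0F}    x≢y = ⊥-elim (x≢y refl)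
  q-adjacent {b = 1+ 0F} {1+ 0F} x≢y = ⊥-elim (x≢y refl)
  q-adjacent {b = 0F}    {1+ 0F} _   = inj₁ imp-qq
  q-adjacent {b = 1+ 0F} {0F}    _   = inj₂ imp-qq

  p-w-edge : ∀ {j α β η i c} → (toℕ i ≡ 0 → c ≡ false) → (i ≡ var Φ j α → c ≡ sign Φ j α) →
             Edge (p j α β) (w η i c)
  p-w-edge at-x₀ at-literal =
    free-pw (λ (i≡0 , c≡true) → not-¬ (at-x₀ i≡0) c≡true)
            (λ (i≡v , c≡¬s) → not-¬ (at-literal i≡v) c≡¬s)

  module _ (x₀-unused : X0Unused Φ) where

    private
      away-from-x₀ : ∀ {i : Fin n} {c} → 1 ≤ toℕ i → toℕ i ≡ 0 → c ≡ false
      away-from-x₀ 1≤i i≡0 = ⊥-elim (<-irrefl (sym i≡0) 1≤i)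

    InD-p-w : ∀ D {j α β η i c} → InD D (p j α β) → InD D (w η i c) → Edge (p j α β) (w η i c)
    InD-p-w (d4 _ _) {j} {α} (refl , refl) (i≡0 , refl) =
      p-w-edge (λ _ → refl) (λ i≡v → ⊥-elim (x₀-unused j α (trans (cong toℕ (sym i≡v)) i≡0)))
    InD-p-w (d5 _ _ _) (refl , refl , s≡c) (1≤i , refl) =
      p-w-edge (away-from-x₀ 1≤i) (λ _ → sym s≡c)
    InD-p-w (d6 γ _ _ _ _) (refl , refl , v-bit) (refl , 1≤i , i-bit) =
      p-w-edge (away-from-x₀ 1≤i)
               (λ i≡v → ⊥-elim (not-¬ (trans (cong (testBit (toℕ γ) ∘ toℕ) (sym i≡v)) i-bit) v-bit))

    InD-isClique : ∀ D → IsClique (InD D)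
    InD-isClique (d1 _ _) (w _ _ _) (w _ _ _) (inj₁ (refl , refl)) (inj₁ (refl , refl)) =
      w-adjacent (λ _ _ → refl)
    InD-isClique (d1 _ _) (w _ _ _) (w _ _ _) (inj₂ (refl , refl)) (inj₂ (refl , refl)) =
      w-adjacent (λ _ _ → refl)
    InD-isClique (d1 _ _) (w _ _ _) (w _ _ _) (inj₁ (refl , refl)) (inj₂ (refl , refl)) _ = inj₁ free-w12
    InD-isClique (d1 _ _) (w _ _ _) (w _ _ _) (inj₂ (refl , refl)) (inj₁ (refl , refl)) _ = inj₂ free-w12
    InD-isClique (d2 _ _ _ _) (q _ _) (q _ _) (refl , refl) (refl , refl) x≢y = ⊥-elim (x≢y refl)
    InD-isClique (d2 _ _ _ _) (q _ _) (p _ _ _) _ _ _ = inj₁ free-qp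
    InD-isClique (d2 _ _ _ _) (p _ _ _) (q _ _) _ _ _ = inj₂ free-qp
    InD-isClique (d2 _ _ _ _) (p _ _ _) (p _ _ _) (refl , refl) (refl , refl) = p-adjacent (λ _ → refl)
    InD-isClique (d3 _ _ _ _ _) (p _ _ _) (p _ _ _) (inj₁ (_ , refl , refl)) (inj₁ (_ , refl , refl)) =
      p-adjacent (λ _ → refl)
    InD-isClique (d3 _ _ _ _ _) (p _ _ _) (p _ _ _) (inj₂ (_ , refl , refl)) (inj₂ (_ , refl , refl)) =
      p-adjacent (λ _ → refl)
    InD-isClique (d3 _ _ _ _ _) (p _ _ _) (p _ _ _) (inj₁ (bit₀ , refl , refl))
                                                  (inj₂ (bit₁ , refl , refl)) =
      p-adjacent (λ { refl → ⊥-elim (not-¬ bit₀ bit₁) })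
    InD-isClique (d3 _ _ _ _ _) (p _ _ _) (p _ _ _) (inj₂ (bit₁ , refl , refl))
                                                  (inj₁ (bit₀ , refl , refl)) =
      p-adjacent (λ { refl → ⊥-elim (not-¬ bit₀ bit₁) })
    InD-isClique D@(d4 _ _) (p _ _ _) (w _ _ _) ∈D ∈D' _ = inj₁ (InD-p-w D ∈D ∈D')
    InD-isClique D@(d4 _ _) (w _ _ _) (p _ _ _) ∈D ∈D' _ = inj₂ (InD-p-w D ∈D' ∈D)
    InD-isClique (d4 _ _) (w _ _ _) (w _ _ _) (_ , refl) (_ , refl) = w-adjacent (λ _ _ → refl)
    InD-isClique (d4 _ _) (p _ _ _) (p _ _ _) (refl , refl) (refl , refl) = p-adjacent (λ _ → refl)
    InD-isClique D@(d5 _ _ _) (p _ _ _) (w _ _ _) ∈D ∈D' _ = inj₁ (InD-p-w D ∈D ∈D')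
    InD-isClique D@(d5 _ _ _) (w _ _ _) (p _ _ _) ∈D ∈D' _ = inj₂ (InD-p-w D ∈D' ∈D)
    InD-isClique (d5 _ _ _) (w _ _ _) (w _ _ _) (_ , refl) (_ , refl) = w-adjacent (λ _ _ → refl)
    InD-isClique (d5 _ _ _) (p _ _ _) (p _ _ _) (refl , refl , _) (refl , refl , _) = p-adjacent (λ _ → refl)
    InD-isClique D@(d6 _ _ _ _ _) (p _ _ _) (w _ _ _) ∈D ∈D' _ = inj₁ (InD-p-w D ∈D ∈D')
    InD-isClique D@(d6 _ _ _ _ _) (w _ _ _) (p _ _ _) ∈D ∈D' _ = inj₂ (InD-p-w D ∈D' ∈D)
    InD-isClique (d6 _ _ _ _ _) (w _ _ _) (w _ _ _) (refl , _) (refl , _) = w-adjacent (λ _ _ → refl)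
    InD-isClique (d6 _ _ _ _ _) (p _ _ _) (p _ _ _) (refl , refl , _) (refl , refl , _) =
      p-adjacent (λ _ → refl)

  private
    -- Ordered as N = (4 + 24 + 6 + 12) + 36 ⌈log₂ m⌉ + 24 ℓ, so that the enumeration below has size N
    -- by computation.
    IdxCode : Set
    IdxCode =
        (  ((Bool × Bool) ⊎ (((Fin 2 × Fin 2) × Fin 3) × Fin 2) ⊎ (Fin 3 × Fin 2) ⊎ ((Fin 3 × Fin 2) × Bool))
         ⊎ ((Fin 3 × Fin 2) × (Fin 3 × Fin 2)) × Fin ⌈log₂ m ⌉)
      ⊎ ((Fin 3 × Fin 2) × (Bool × Bool)) × Fin ℓ

    decode : IdxCode → DIdx
    decode (inj₁ (inj₁ (inj₁ (c , c'))))                          = d1 c c'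
    decode (inj₁ (inj₁ (inj₂ (inj₁ (((a , b) , α') , β')))))      = d2 a b α' β'
    decode (inj₁ (inj₁ (inj₂ (inj₂ (inj₁ (α , β))))))             = d4 α β
    decode (inj₁ (inj₁ (inj₂ (inj₂ (inj₂ ((α , β) , c))))))       = d5 α β c
    decode (inj₁ (inj₂ (((α , β) , (α' , β')) , γ)))              = d3 γ α β α' β'
    decode (inj₂ (((α , β) , (c , c')) , γ))                      = d6 γ α β c c'

    decode-onto : ∀ D → ∃ λ x → decode x ≡ D
    decode-onto (d1 c c')          = inj₁ (inj₁ (inj₁ (c , c'))) , refl
    decode-onto (d2 a b α' β')     = inj₁ (inj₁ (inj₂ (inj₁ (((a , b) , α') , β')))) , refl
    decode-onto (d4 α β)           = inj₁ (inj₁ (inj₂ (inj₂ (inj₁ (α , β))))) , refl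
    decode-onto (d5 α β c)         = inj₁ (inj₁ (inj₂ (inj₂ (inj₂ ((α , β) , c))))) , refl
    decode-onto (d3 γ α β α' β')   = inj₁ (inj₂ (((α , β) , (α' , β')) , γ)) , refl
    decode-onto (d6 γ α β c c')    = inj₂ (((α , β) , (c , c')) , γ) , refl

  DIdx-enum : Fin (46 + 36 * ⌈log₂ m ⌉ + 24 * ℓ) ↠ DIdx
  DIdx-enum = enum-image codes decode decode-onto
    where
    literal : Fin (3 * 2) ↠ (Fin 3 × Fin 2)
    literal = enum-× enum-Fin enum-Fin

    codes : Fin (46 + 36 * ⌈log₂ m ⌉ + 24 * ℓ) ↠ IdxCode
    codes = enum-⊎ (enum-⊎ (enum-⊎ (enum-× enum-Bool enum-Bool)
                             (enum-⊎ (enum-× (enum-× (enum-× enum-Fin enum-Fin) enum-Fin) enum-Fin)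
                             (enum-⊎ literal (enum-× literal enum-Bool))))
                           (enum-× (enum-× literal literal) enum-Fin))
                   (enum-× (enum-× literal (enum-× enum-Bool enum-Bool)) enum-Fin)

  cliqueCover : ∀ {k} {I : Set} → Fin k ↠ I → (C : I → V → Set) → (∀ t → IsClique (C t)) →
                (∀ {x y} → Edge x y → ∃ λ t → C t x × C t y) → CliqueCover k
  cliqueCover e C cliques covers = C ∘ to , cliques ∘ to , λ _ _ → covers-Adj
    where
    open Surjection e using (to; to⁻; to∘to⁻)

    reindex : ∀ {x y} → (∃ λ t → C t x × C t y) → ∃ λ s → C (to s) x × C (to s) y
    reindex {x} {y} (t , ∈x , ∈y) = to⁻ t , subst (λ t → C t x × C t y) (sym (to∘to⁻ t)) (∈x , ∈y)

    covers-Adj : ∀ {x y} → Adj x y → ∃ λ s → C (to s) x × C (to s) y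
    covers-Adj (inj₁ x~y) = reindex (covers x~y)
    covers-Adj (inj₂ y~x) with covers y~x
    ... | t , ∈y , ∈x = reindex (t , ∈x , ∈y)

private
  xor-≢ : ∀ {a b} → a ≢ b → a xor b ≡ true
  xor-≢ {true}  {true}  a≢b = ⊥-elim (a≢b refl)
  xor-≢ {false} {false} a≢b = ⊥-elim (a≢b refl)
  xor-≢ {true}  {false} _   = refl
  xor-≢ {false} {true}  _   = refl

  xor-cancelˡ : ∀ a b → a xor (a xor b) ≡ b
  xor-cancelˡ a b = trans (sym (xor-assoc a a b)) (cong (_xor b) (xor-same a))

module BalancedCover {ℓ' m : ℕ} (Φ : Formula (2 ^ suc ℓ') m) (x₀-unused : X0Unused Φ)
                     (σ : Fin (2 ^ suc ℓ') → Bool) (σ-satisfies : Satisfies Φ σ)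
                     (σ-x₀ : ∀ i → toℕ i ≡ 0 → σ i ≡ false) (balanced : count σ ≡ 2 ^ ℓ') where

  open Construction (suc ℓ') m Φ
  open Graph (suc ℓ') m Φ
  open BalancedLabels {ℓ'} σ balanced using (labelBit; distinguish)

  satisfied : Fin m → Fin 3
  satisfied j = proj₁ (σ-satisfies j)

  data Clique : Set where
    labelled      : (η : Fin 2) (γ : Fin ℓ') (b : Bool) → Clique
    trueLiterals  : Clique
    falseLiterals : Clique
    otherLiterals : Fin 2 → Clique
    closedNbhd    : DIdx → Clique

  data _∋_ : Clique → V → Set where
    labelled-u      : ∀ {η γ b} → labelled η γ b ∋ u η γ
    labelled-w      : ∀ {η γ b i c} → c ≡ labelBit γ i xor b → labelled η γ b ∋ w η i c
    trueLiterals-w  : ∀ {η i c} → c ≡ σ i → trueLiterals ∋ w η i c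
    trueLiterals-p  : ∀ {j α β} → α ≡ satisfied j → trueLiterals ∋ p j α β
    falseLiterals-w : ∀ {η i c} → c ≡ not (σ i) → falseLiterals ∋ w η i c
    otherLiterals-p : ∀ {a j α β} → α ≡ punchIn (satisfied j) a → otherLiterals a ∋ p j α β
    otherLiterals-q : ∀ {a b} → otherLiterals a ∋ q a b
    closedNbhd-s    : ∀ {D} → closedNbhd D ∋ s D
    closedNbhd-D    : ∀ {D x} → InD D x → closedNbhd D ∋ x

  satisfied-edge : ∀ {j β η i} → Edge (p j (satisfied j) β) (w η i (σ i))
  satisfied-edge {j} = p-w-edge (σ-x₀ _) (λ { refl → proj₂ (σ-satisfies j) })

  ∋-isClique : ∀ t → IsClique (t ∋_)
  ∋-isClique _ _ _ labelled-u labelled-u x≢y = ⊥-elim (x≢y refl)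
  ∋-isClique _ _ _ labelled-u (labelled-w _) _ = inj₁ imp-uw
  ∋-isClique _ _ _ (labelled-w _) labelled-u _ = inj₂ imp-uw
  ∋-isClique _ _ _ (labelled-w refl) (labelled-w refl) = w-adjacent (λ { _ refl → refl })
  ∋-isClique _ _ _ (trueLiterals-w refl) (trueLiterals-w refl) = w-adjacent (λ { _ refl → refl })
  ∋-isClique _ _ _ (trueLiterals-w refl) (trueLiterals-p refl) _ = inj₂ satisfied-edge
  ∋-isClique _ _ _ (trueLiterals-p refl) (trueLiterals-w refl) _ = inj₁ satisfied-edge
  ∋-isClique _ _ _ (trueLiterals-p refl) (trueLiterals-p refl) = p-adjacent (λ { refl → refl })
  ∋-isClique _ _ _ (falseLiterals-w refl) (falseLiterals-w refl) = w-adjacent (λ { _ refl → refl })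
  ∋-isClique _ _ _ (otherLiterals-p refl) (otherLiterals-p refl) = p-adjacent (λ { refl → refl })
  ∋-isClique _ _ _ (otherLiterals-p _) otherLiterals-q _ = inj₂ free-qp
  ∋-isClique _ _ _ otherLiterals-q (otherLiterals-p _) _ = inj₁ free-qp
  ∋-isClique _ _ _ otherLiterals-q otherLiterals-q = q-adjacent
  ∋-isClique _ _ _ closedNbhd-s closedNbhd-s x≢y = ⊥-elim (x≢y refl)
  ∋-isClique _ _ _ closedNbhd-s (closedNbhd-D ∈D) _ = inj₁ (sD ∈D)
  ∋-isClique _ _ _ (closedNbhd-D ∈D) closedNbhd-s _ = inj₂ (sD ∈D)
  ∋-isClique _ x y (closedNbhd-D ∈D) (closedNbhd-D ∈D') = InD-isClique x₀-unused _ x y ∈D ∈D'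

  imp-ww-covered : ∀ {η i i'} → i ≢ i' → ∃ λ t → t ∋ w η i false × t ∋ w η i' true
  imp-ww-covered {η} {i} {i'} i≢i' with distinguish i≢i'
  ... | inj₂ (γ , bits≢) =
    labelled η γ (labelBit γ i) , labelled-w (sym (xor-same (labelBit γ i)))
                                , labelled-w (sym (xor-≢ (bits≢ ∘ sym)))
  ... | inj₁ σ≢ with σ i in σi | σ i' in σi'
  ...   | false | true  = trueLiterals , trueLiterals-w (sym σi) , trueLiterals-w (sym σi')
  ...   | true  | false =
    falseLiterals , falseLiterals-w (cong not (sym σi)) , falseLiterals-w (cong not (sym σi'))
  ...   | false | false = ⊥-elim (σ≢ refl)
  ...   | true  | true  = ⊥-elim (σ≢ refl)

  free-pp-covered : ∀ {j α β j' α' β'} → j ≢ j' → ∃ λ t → t ∋ p j α β × t ∋ p j' α' β'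
  free-pp-covered {j} {α} {β} {j'} {α'} {β'} j≢j'
    with differingBit ⌈log₂ m ⌉ (toℕ<2^⌈log₂n⌉ j) (toℕ<2^⌈log₂n⌉ j') (j≢j' ∘ toℕ-injective)
  ... | γ , bits≢ with testBit (toℕ γ) (toℕ j) in bit | testBit (toℕ γ) (toℕ j') in bit'
  ...   | false | true  = closedNbhd (d3 γ α β α' β') , closedNbhd-D (inj₁ (bit , refl , refl))
                                                     , closedNbhd-D (inj₂ (bit' , refl , refl))
  ...   | true  | false = closedNbhd (d3 γ α' β' α β) , closedNbhd-D (inj₂ (bit , refl , refl))
                                                     , closedNbhd-D (inj₁ (bit' , refl , refl))
  ...   | false | false = ⊥-elim (bits≢ refl)
  ...   | true  | true  = ⊥-elim (bits≢ refl)

  free-pw-covered : ∀ {j α β η i c} → ¬ (toℕ i ≡ 0 × c ≡ true) →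
                       ¬ (i ≡ var Φ j α × c ≡ not (sign Φ j α)) →
                       ∃ λ t → t ∋ p j α β × t ∋ w η i c
  free-pw-covered {j} {α} {β} {η} {i} {c} not-x₀-true not-complement with toℕ i Data.Nat.≟ 0
  ... | yes i≡0 =
    closedNbhd (d4 α β) , closedNbhd-D (refl , refl) , closedNbhd-D (i≡0 , ¬-not (not-x₀-true ∘ (i≡0 ,_)))
  ... | no i≢0 with i Data.Fin.≟ var Φ j α
  ...   | yes i≡v =
    closedNbhd (d5 α β c) , closedNbhd-D (refl , refl , sym c≡s) , closedNbhd-D (n≢0⇒n>0 i≢0 , refl)
    where
    c≡s : c ≡ sign Φ j α
    c≡s = trans (¬-not (not-complement ∘ (i≡v ,_))) (not-involutive _)
  ...   | no i≢v with differingBit (suc ℓ') (toℕ<n i) (toℕ<n (var Φ j α)) (i≢v ∘ toℕ-injective)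
  ...     | γ , bits≢ = closedNbhd (d6 γ α β c (testBit (toℕ γ) (toℕ i)))
                      , closedNbhd-D (refl , refl , ¬-not (bits≢ ∘ sym))
                      , closedNbhd-D (refl , n≢0⇒n>0 i≢0 , refl)

  edge-covered : ∀ {x y} → Edge x y → ∃ λ t → t ∋ x × t ∋ y
  edge-covered (imp-ww i≢i') = imp-ww-covered i≢i'
  edge-covered (imp-uw {η} {γ} {i} {c}) =
    labelled η γ (labelBit γ i xor c) , labelled-u , labelled-w (sym (xor-cancelˡ (labelBit γ i) c))
  edge-covered (imp-pp {j} {α}) with satisfied j Data.Fin.≟ α
  ... | yes refl = trueLiterals , trueLiterals-p refl , trueLiterals-p refl
  ... | no sat≢α = otherLiterals (punchOut sat≢α) , otherLiterals-p α≡ , otherLiterals-p α≡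
    where
    α≡ : α ≡ punchIn (satisfied j) (punchOut sat≢α)
    α≡ = sym (punchIn-punchOut sat≢α)
  edge-covered (imp-qq {a}) = otherLiterals a , otherLiterals-q , otherLiterals-q
  edge-covered (free-ww {0F} {c = c} _) =
    closedNbhd (d1 c c) , closedNbhd-D (inj₁ (refl , refl)) , closedNbhd-D (inj₁ (refl , refl))
  edge-covered (free-ww {1+ 0F} {c = c} _) =
    closedNbhd (d1 c c) , closedNbhd-D (inj₂ (refl , refl)) , closedNbhd-D (inj₂ (refl , refl))
  edge-covered (free-w12 {c = c} {c' = c'}) =
    closedNbhd (d1 c c') , closedNbhd-D (inj₁ (refl , refl)) , closedNbhd-D (inj₂ (refl , refl))
  edge-covered (free-qp {a} {b} {j} {α} {β}) =
    closedNbhd (d2 a b α β) , closedNbhd-D (refl , refl) , closedNbhd-D (refl , refl)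
  edge-covered (free-pp j≢j') = free-pp-covered j≢j'
  edge-covered (free-pw not-x₀-true not-complement) =
    free-pw-covered not-x₀-true not-complement
  edge-covered (sD ∈D) = closedNbhd _ , closedNbhd-s , closedNbhd-D ∈D

  Clique-enum : Fin (4 * suc ℓ' + (46 + 36 * ⌈log₂ m ⌉ + 24 * suc ℓ')) ↠ Clique
  Clique-enum = enum-image (enum-⊎ (enum-× (enum-× enum-Fin enum-Bool) enum-Fin) DIdx-enum)
                           [ fromBase , closedNbhd ] onto
    where
    -- 4ℓ = 4(ℓ − 1) + 4: the four codes at position 0F name the cliques that carry no label bit.
    fromBase : (Fin 2 × Bool) × Fin (suc ℓ') → Clique
    fromBase ((η , b) , 1+ γ)          = labelled η γ b
    fromBase ((0F , false) , 0F)       = trueLiterals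
    fromBase ((0F , true) , 0F)        = falseLiterals
    fromBase ((1+ 0F , false) , 0F)    = otherLiterals 0F
    fromBase ((1+ 0F , true) , 0F)     = otherLiterals (1+ 0F)

    onto : ∀ t → ∃ λ x → [ fromBase , closedNbhd ] x ≡ t
    onto (labelled η γ b)         = inj₁ ((η , b) , 1+ γ) , refl
    onto trueLiterals             = inj₁ ((0F , false) , 0F) , refl
    onto falseLiterals            = inj₁ ((0F , true) , 0F) , refl
    onto (otherLiterals 0F)       = inj₁ ((1+ 0F , false) , 0F) , refl
    onto (otherLiterals (1+ 0F))  = inj₁ ((1+ 0F , true) , 0F) , refl
    onto (closedNbhd D)           = inj₂ D , refl

  cover : CliqueCover (kParam (suc ℓ') m)
  cover = cliqueCover (subst (λ k → Fin k ↠ Clique) size≡ Clique-enum) _∋_ ∋-isClique edge-covered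
    where
    size≡ : 4 * suc ℓ' + (46 + 36 * ⌈log₂ m ⌉ + 24 * suc ℓ') ≡ kParam (suc ℓ') m
    size≡ = sym (trans (cong (_+ 24 * suc ℓ') (+-assoc (4 * suc ℓ') 46 _)) (+-assoc (4 * suc ℓ') _ _))

lemma11 : (ℓ m : ℕ) (Φ : Formula (2 ^ ℓ) m) →
          1 ≤ ℓ → 1 ≤ m →
          DistinctVars Φ → X0Unused Φ → BalancedProperty Φ →
          Satisfiable Φ →
          Construction.CliqueCover ℓ m Φ (kParam ℓ m)
lemma11 (suc ℓ') m Φ _ _ _ x₀-unused balanced satisfiable with balanced satisfiable
... | σ , σ-satisfies , σ-count , σ-x₀ =
  BalancedCover.cover Φ x₀-unused σ σ-satisfies σ-x₀ half
  where
  half : count σ ≡ 2 ^ ℓ'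
  half = begin
    count σ             ≡⟨ countTrue≡count Φ σ ⟨
    countTrue Φ σ       ≡⟨ σ-count ⟩
    2 * 2 ^ ℓ' / 2      ≡⟨ cong (_/ 2) (*-comm 2 (2 ^ ℓ')) ⟩
    2 ^ ℓ' * 2 / 2      ≡⟨ m*n/n≡m (2 ^ ℓ') 2 ⟩
    2 ^ ℓ'              ∎
    where open ≡-Reasoning
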